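{- For every integer $n\ge3$, the wheel graph $W_n$ satisfies $\operatorname{mfgon}(W_n)=\lceil n/2\rceil+1$.
   Context: The wheel graph $W_n$ ($n\ge3$) is the simple graph on $n+1$ vertices consisting of a cycle on $n$ vertices together with one additional vertex adjacent to every cycle vertex. A divisor is an integer combination $D=\sum_vD(v)(v)$ of vertices, degree $\sum_vD(v)$, effective if all $D(v)\ge0$. Divisors are equivalent if their difference lies in the integer column space of the Laplacian. The rank $r(D)$ is $-1$ if $D$ is not equivalent to an effective divisor, else the largest $r\ge0$ such that $D-E$ is equivalent to an effective divisor for all effective $E$ of degree $r$. $\operatorname{mfgon}(G)$ is the minimum degree of a positive-rank effective divisor $D$ with $D(v)\le1$ for all $v$. -}

module Defs where

open import Data.Nat as ℕ using (ℕ; zero; suc)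
open import Data.Fin using (Fin; zero; suc; toℕ; _≟_)
open import Data.Bool using (Bool; true; false; if_then_else_; _∨_)
open import Data.Integer using (ℤ; +_; _+_; _-_; _*_; _≤_)
open import Data.Product using (Σ; _×_; ∃)
open import Relation.Binary.PropositionalEquality using (_≡_)
open import Relation.Nullary.Decidable using (⌊_⌋)

∑ : ∀ {m} → (Fin m → ℤ) → ℤ
∑ {zero}  f = + 0
∑ {suc m} f = f zero + ∑ (λ i → f (suc i))

-- Graphs on vertex set Fin m, given by a symmetric 0/1 adjacency function.

Adjacency : ℕ → Set
Adjacency m = Fin m → Fin m → Bool

b2z : Bool → ℤ
b2z true  = + 1
b2z false = + 0

vdeg : ∀ {m} → Adjacency m → Fin m → ℤ
vdeg A v = ∑ (λ w → b2z (A v w))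

laplacian : ∀ {m} → Adjacency m → Fin m → Fin m → ℤ
laplacian A v w = (if ⌊ v ≟ w ⌋ then vdeg A v else + 0) - b2z (A v w)

Divisor : ℕ → Set
Divisor m = Fin m → ℤ

degree : ∀ {m} → Divisor m → ℤ
degree D = ∑ D

Effective : ∀ {m} → Divisor m → Set
Effective D = ∀ v → + 0 ≤ D v

_-ᴰ_ : ∀ {m} → Divisor m → Divisor m → Divisor m
(D -ᴰ E) v = D v - E v

Equivalent : ∀ {m} → Adjacency m → Divisor m → Divisor m → Set
Equivalent A D D' =
  Σ (Fin _ → ℤ) λ x → ∀ v → D v - D' v ≡ ∑ (λ w → laplacian A v w * x w)

EquivEffective : ∀ {m} → Adjacency m → Divisor m → Set
EquivEffective A D = Σ (Divisor _) λ D' → Effective D' × Equivalent A D D'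

-- r(D) ≥ r  (for r ≥ 0): for every effective E of degree r, D - E is
-- equivalent to an effective divisor.  (The rank is the largest such r,
-- or -1 if none; so r(D) ≥ 1 iff RankAtLeast A D 1.)
RankAtLeast : ∀ {m} → Adjacency m → Divisor m → ℕ → Set
RankAtLeast A D r =
  ∀ E → Effective E → degree E ≡ + r → EquivEffective A (D -ᴰ E)

MfgonCandidate : ∀ {m} → Adjacency m → Divisor m → Set
MfgonCandidate A D = Effective D × (∀ v → D v ≤ + 1) × RankAtLeast A D 1

IsMfgon : ∀ {m} → Adjacency m → ℕ → Set
IsMfgon A k =
  (Σ (Divisor _) λ D → MfgonCandidate A D × degree D ≡ + k)
  × (∀ D → MfgonCandidate A D → + k ≤ degree D)

-- Wheel graph W_n on Fin (suc n): vertex zero is the hub, vertex suc i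
-- (i : Fin n) is the i-th vertex of the n-cycle.

cycleAdj : ∀ {n} → Fin n → Fin n → Bool
cycleAdj {n} i j =
  ⌊ toℕ j ℕ.≟ suc (toℕ i) ⌋ ∨ ⌊ toℕ i ℕ.≟ suc (toℕ j) ⌋ ∨
  (⌊ toℕ i ℕ.≟ 0 ⌋ Data.Bool.∧ ⌊ suc (toℕ j) ℕ.≟ n ⌋) ∨
  (⌊ toℕ j ℕ.≟ 0 ⌋ Data.Bool.∧ ⌊ suc (toℕ i) ℕ.≟ n ⌋)

wheel : (n : ℕ) → Adjacency (suc n)
wheel n zero    zero    = false
wheel n zero    (suc _) = true
wheel n (suc _) zero    = true
wheel n (suc i) (suc j) = cycleAdj i j

{-# OPTIONS --safe #-}
-- The hub together with the even-indexed rim vertices has degree ⌈ n /2⌉ + 1 and rank one: a chip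
-- missing at an odd rim vertex is recovered by letting that vertex borrow from its three neighbours,
-- each of which carries a chip.
--
-- For the lower bound let D be a 0/1 divisor of rank one, q a vertex with D q = 0, and x a firing
-- script with D - (q) - Q x effective, so Q x ≤ D and (Q x) q < 0. At a vertex where x attains its
-- maximum, (Q x) is at least the number of neighbours where it does not; as Q x ≤ D ≤ 1, a maximal
-- vertex has at most one lower neighbour, none if it carries no chip, and q is not maximal. If the
-- hub is not maximal it is the one lower neighbour of every maximal rim vertex, so maximality
-- propagates to the rim successor and the whole rim is maximal. Hence an empty rim vertex
-- is impossible when the hub is empty (take q the hub), and two adjacent empty rim vertices are
-- impossible when the hub carries a chip (take q the first of them). Counting chips on the rim gives
-- deg D ≥ n or deg D ≥ 1 + ⌈ n /2⌉ respectively.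
module Submission where

open import Defs
open import Data.Nat as ℕ using (ℕ; zero; suc; z≤n; s≤s; ⌈_/2⌉; ⌊_/2⌋)
import Data.Nat.Properties as ℕP
open import Data.Integer as ℤ using (ℤ; +_; _+_; _-_; _*_; -_; _≤_; _<_; +≤+; -<+)
import Data.Integer.Properties as ℤP
open import Data.Integer.Tactic.RingSolver using (solve-∀)
open import Data.Fin using (Fin; zero; suc; toℕ; fromℕ; inject₁; lower₁; _≟_)
import Data.Fin.Properties as FinP
open import Data.Fin.Induction using (<-weakInduction; <-weakInduction-startingFrom)
open import Data.Bool using (Bool; true; false; not; T; T?; if_then_else_; _∧_)
open import Data.Bool.Properties using (T-∨; T-∧; not-involutive; not-injective)
open import Data.Unit using (tt)
open import Data.Product using (Σ; ∃; _×_; _,_; proj₁; proj₂)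
open import Data.Sum using (_⊎_; inj₁; inj₂)
open import Function using (Equivalence; _∘_)
open import Relation.Nullary using (¬_; yes; no; contradiction)
open import Relation.Nullary.Decidable
  using (⌊_⌋; _×-dec_; toWitness; fromWitness; decidable-stable; dec-true; dec-false; isYes≗does; ⌊⌋-map′)
open import Relation.Binary.PropositionalEquality
  using (_≡_; _≢_; refl; sym; trans; cong; cong₂; subst; subst₂; module ≡-Reasoning)
import Algebra.Properties.Semiring.Sum ℤP.+-*-semiring as Sum

open Equivalence using (to; from)

+suc≰+ : ∀ {n} → ¬ (+ suc n ≤ + n)
+suc≰+ p = ℕP.1+n≰n (ℤP.drop‿+≤+ p)

i-j≤i : ∀ {i j} → + 0 ≤ j → i - j ≤ i
i-j≤i {i} 0≤j = subst (i - _ ≤_) (ℤP.+-identityʳ i) (ℤP.+-monoʳ-≤ i (ℤP.neg-mono-≤ 0≤j))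

<⇒1≤- : ∀ {i j} → i < j → + 1 ≤ j - i
<⇒1≤- {i} {j} i<j = subst (_≤ j - i) (cancel i) (ℤP.+-monoˡ-≤ (- i) (ℤP.i<j⇒suc[i]≤j i<j))
  where
  cancel : ∀ i → + 1 + i - i ≡ + 1
  cancel = solve-∀

zero-or-one : ∀ {i} → + 0 ≤ i → i ≤ + 1 → i ≡ + 0 ⊎ i ≡ + 1
zero-or-one {+ 0}           _ _                = inj₁ refl
zero-or-one {+ 1}           _ _                = inj₂ refl
zero-or-one {+ suc (suc _)} _ (+≤+ (s≤s ()))

nonneg-sum-one : ∀ {i j} → + 0 ≤ i → + 0 ≤ j → i + j ≡ + 1 →
  (i ≡ + 0 × j ≡ + 1) ⊎ (i ≡ + 1 × j ≡ + 0)
nonneg-sum-one {+ 0}     {+ j} _ _ i+j≡1 = inj₁ (refl , i+j≡1)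
nonneg-sum-one {+ suc i} {+ j} _ _ i+j≡1 =
  inj₂ (cong (λ k → + suc k) (ℕP.m+n≡0⇒m≡0 i i+j≡0) , cong +_ (ℕP.m+n≡0⇒n≡0 i i+j≡0))
  where
  i+j≡0 : i ℕ.+ j ≡ 0
  i+j≡0 = ℕP.suc-injective (ℤP.+-injective i+j≡1)

⌈/2⌉-≤ : ∀ {n c} → + n ≤ c + c → + ⌈ n /2⌉ ≤ c
⌈/2⌉-≤ {n} {+ c} (+≤+ n≤c+c) =
  +≤+ (ℕP.≤-trans (ℕP.⌈n/2⌉-mono n≤c+c) (ℕP.≤-reflexive (sym (ℕP.n≡⌈n+n/2⌉ c))))

⌈/2⌉+1≤ : ∀ {n} → 2 ℕ.≤ n → ⌈ n /2⌉ ℕ.+ 1 ℕ.≤ n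
⌈/2⌉+1≤ {suc (suc n)} (s≤s (s≤s z≤n)) = subst (ℕ._≤ suc (suc n)) (ℕP.+-comm 1 _) (ℕP.⌈n/2⌉<n n)

∑≡sum : ∀ {m} (f : Fin m → ℤ) → ∑ f ≡ Sum.sum f
∑≡sum {zero}  f = refl
∑≡sum {suc m} f = cong (_+_ (f zero)) (∑≡sum (λ i → f (suc i)))

∑-cong : ∀ {m} {f g : Fin m → ℤ} → (∀ i → f i ≡ g i) → ∑ f ≡ ∑ g
∑-cong {f = f} {g} f≗g rewrite ∑≡sum f | ∑≡sum g = Sum.sum-cong-≗ f≗g

∑-distrib-+ : ∀ {m} (f g : Fin m → ℤ) → ∑ (λ i → f i + g i) ≡ ∑ f + ∑ g
∑-distrib-+ f g rewrite ∑≡sum f | ∑≡sum g | ∑≡sum (λ i → f i + g i) = Sum.∑-distrib-+ f g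

∑-distribʳ-* : ∀ {m} (f : Fin m → ℤ) c → ∑ (λ i → f i * c) ≡ ∑ f * c
∑-distribʳ-* f c rewrite ∑≡sum f | ∑≡sum (λ i → f i * c) = sym (Sum.*-distribʳ-sum c f)

∑-init-last : ∀ {m} (f : Fin (suc m) → ℤ) → ∑ f ≡ ∑ (λ i → f (inject₁ i)) + f (fromℕ m)
∑-init-last f rewrite ∑≡sum f | ∑≡sum (λ i → f (inject₁ i)) = Sum.sum-init-last f

∑-neg : ∀ {m} (f : Fin m → ℤ) → ∑ (λ i → - f i) ≡ - ∑ f
∑-neg f = begin
  ∑ (λ i → - f i)       ≡⟨ ∑-cong (λ i → sym (i*-1≡-i (f i))) ⟩
  ∑ (λ i → f i * - + 1) ≡⟨ ∑-distribʳ-* f (- + 1) ⟩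
  ∑ f * - + 1           ≡⟨ i*-1≡-i (∑ f) ⟩
  - ∑ f                 ∎
  where
  open ≡-Reasoning
  i*-1≡-i : ∀ i → i * - + 1 ≡ - i
  i*-1≡-i = solve-∀

∑-distrib-- : ∀ {m} (f g : Fin m → ℤ) → ∑ (λ i → f i - g i) ≡ ∑ f - ∑ g
∑-distrib-- f g = trans (∑-distrib-+ f (λ i → - g i)) (cong (_+_ (∑ f)) (∑-neg g))

∑-nonneg : ∀ {m} {f : Fin m → ℤ} → (∀ i → + 0 ≤ f i) → + 0 ≤ ∑ f
∑-nonneg {zero}  f≥0 = ℤP.≤-refl
∑-nonneg {suc m} f≥0 = ℤP.+-mono-≤ (f≥0 zero) (∑-nonneg (λ i → f≥0 (suc i)))

∑-≥-length : ∀ {m} {f : Fin m → ℤ} → (∀ i → + 1 ≤ f i) → + m ≤ ∑ f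
∑-≥-length {zero}  f≥1 = ℤP.≤-refl
∑-≥-length {suc m} f≥1 = ℤP.+-mono-≤ (f≥1 zero) (∑-≥-length (λ i → f≥1 (suc i)))

term≤∑ : ∀ {m} {f : Fin m → ℤ} → (∀ i → + 0 ≤ f i) → ∀ i → f i ≤ ∑ f
term≤∑ {suc m} {f} f≥0 zero =
  subst (_≤ ∑ f) (ℤP.+-identityʳ (f zero)) (ℤP.+-monoʳ-≤ (f zero) (∑-nonneg (λ i → f≥0 (suc i))))
term≤∑ {suc m} {f} f≥0 (suc i) =
  subst (_≤ ∑ f) (ℤP.+-identityˡ (f (suc i))) (ℤP.+-mono-≤ (f≥0 zero) (term≤∑ (λ i → f≥0 (suc i)) i))

two-terms≤∑ : ∀ {m} {f : Fin m → ℤ} → (∀ i → + 0 ≤ f i) → ∀ {i j} → i ≢ j → f i + f j ≤ ∑ f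
two-terms≤∑ {suc m} {f} f≥0 {zero}  {zero}  i≢j = contradiction refl i≢j
two-terms≤∑ {suc m} {f} f≥0 {zero}  {suc j} i≢j =
  ℤP.+-monoʳ-≤ (f zero) (term≤∑ (λ i → f≥0 (suc i)) j)
two-terms≤∑ {suc m} {f} f≥0 {suc i} {zero}  i≢j =
  subst (_≤ ∑ f) (ℤP.+-comm (f zero) (f (suc i)))
    (ℤP.+-monoʳ-≤ (f zero) (term≤∑ (λ i → f≥0 (suc i)) i))
two-terms≤∑ {suc m} {f} f≥0 {suc i} {suc j} i≢j =
  subst (_≤ ∑ f) (ℤP.+-identityˡ _)
    (ℤP.+-mono-≤ (f≥0 zero) (two-terms≤∑ (λ i → f≥0 (suc i)) (λ i≡j → i≢j (cong suc i≡j))))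

∑-zero : ∀ m → ∑ {m} (λ _ → + 0) ≡ + 0
∑-zero zero    = refl
∑-zero (suc m) = trans (ℤP.+-identityˡ _) (∑-zero m)

∑-nonneg-≡0 : ∀ {m} {f : Fin m → ℤ} → (∀ i → + 0 ≤ f i) → ∑ f ≡ + 0 → ∀ i → f i ≡ + 0
∑-nonneg-≡0 {f = f} f≥0 ∑f≡0 i = ℤP.≤-antisym (subst (f i ≤_) ∑f≡0 (term≤∑ f≥0 i)) (f≥0 i)

≟-suc : ∀ {m} (v w : Fin m) → ⌊ suc v ≟ suc w ⌋ ≡ ⌊ v ≟ w ⌋
≟-suc v w = ⌊⌋-map′ (cong suc) FinP.suc-injective (v ≟ w)

δ : ∀ {m} → Fin m → Divisor m
δ v w = b2z ⌊ v ≟ w ⌋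

b2z-nonneg : ∀ b → + 0 ≤ b2z b
b2z-nonneg true  = +≤+ z≤n
b2z-nonneg false = +≤+ z≤n

b2z≤1 : ∀ b → b2z b ≤ + 1
b2z≤1 true  = ℤP.≤-refl
b2z≤1 false = +≤+ z≤n

b2z-T : ∀ {b} → T b → b2z b ≡ + 1
b2z-T {true} _ = refl

b2z-¬T : ∀ {b} → ¬ T b → b2z b ≡ + 0
b2z-¬T {true}  ¬t = contradiction tt ¬t
b2z-¬T {false} _  = refl

δ-effective : ∀ {m} (v : Fin m) → Effective (δ v)
δ-effective v w = b2z-nonneg ⌊ v ≟ w ⌋

δ-self : ∀ {m} (v : Fin m) → δ v v ≡ + 1
δ-self v = cong b2z (trans (isYes≗does (v ≟ v)) (dec-true (v ≟ v) refl))

δ-other : ∀ {m} {v w : Fin m} → v ≢ w → δ v w ≡ + 0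
δ-other {v = v} {w} v≢w = cong b2z (trans (isYes≗does (v ≟ w)) (dec-false (v ≟ w) v≢w))

∑-*-δ : ∀ {m} (g : Fin m → ℤ) (v : Fin m) → ∑ (λ u → g u * δ v u) ≡ g v
∑-*-δ {suc m} g zero = begin
  g zero * + 1 + ∑ (λ u → g (suc u) * + 0)
    ≡⟨ cong₂ _+_ (ℤP.*-identityʳ (g zero)) (∑-cong (λ u → ℤP.*-zeroʳ (g (suc u)))) ⟩
  g zero + ∑ {m} (λ _ → + 0)
    ≡⟨ cong (_+_ (g zero)) (∑-zero m) ⟩
  g zero + + 0
    ≡⟨ ℤP.+-identityʳ (g zero) ⟩
  g zero
    ∎
  where open ≡-Reasoning
∑-*-δ {suc m} g (suc v) = begin
  g zero * + 0 + ∑ (λ u → g (suc u) * δ (suc v) (suc u))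
    ≡⟨ cong₂ _+_ (ℤP.*-zeroʳ (g zero)) (∑-cong (λ u → cong (λ b → g (suc u) * b2z b) (≟-suc v u))) ⟩
  + 0 + ∑ (λ u → g (suc u) * δ v u)
    ≡⟨ ℤP.+-identityˡ _ ⟩
  ∑ (λ u → g (suc u) * δ v u)
    ≡⟨ ∑-*-δ (λ u → g (suc u)) v ⟩
  g (suc v)
    ∎
  where open ≡-Reasoning

degree-δ : ∀ {m} (v : Fin m) → degree (δ v) ≡ + 1
degree-δ v = trans (∑-cong (λ u → sym (ℤP.*-identityˡ (δ v u)))) (∑-*-δ (λ _ → + 1) v)

degree-one-effective : ∀ {m} {E : Divisor m} → Effective E → degree E ≡ + 1 →
  ∃ λ v → ∀ w → E w ≡ δ v w
degree-one-effective {suc m} {E} E≥0 deg≡1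
  with nonneg-sum-one (E≥0 zero) (∑-nonneg (λ i → E≥0 (suc i))) deg≡1
... | inj₁ (E₀≡0 , rest≡1) with degree-one-effective (λ i → E≥0 (suc i)) rest≡1
...   | v , E≗δv = suc v , λ { zero → E₀≡0 ; (suc w) → trans (E≗δv w) (cong b2z (sym (≟-suc v w))) }
degree-one-effective {suc m} {E} E≥0 deg≡1
    | inj₂ (E₀≡1 , rest≡0) =
  zero , λ { zero → E₀≡1 ; (suc w) → ∑-nonneg-≡0 (λ i → E≥0 (suc i)) rest≡0 w }

applyLaplacian : ∀ {m} → Adjacency m → (Fin m → ℤ) → Divisor m
applyLaplacian A x v = ∑ (λ w → laplacian A v w * x w)

select-as-δ : ∀ b c y → (if b then c else + 0) * y ≡ y * c * b2z b
select-as-δ true  c y = reorder c y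
  where
  reorder : ∀ c y → c * y ≡ y * c * + 1
  reorder = solve-∀
select-as-δ false c y = sym (ℤP.*-zeroʳ (y * c))

∑-diagonal : ∀ {m} (c : ℤ) (x : Fin m → ℤ) (v : Fin m) →
  ∑ (λ u → (if ⌊ v ≟ u ⌋ then c else + 0) * x u) ≡ c * x v
∑-diagonal c x v = begin
  ∑ (λ u → (if ⌊ v ≟ u ⌋ then c else + 0) * x u)
    ≡⟨ ∑-cong (λ u → select-as-δ ⌊ v ≟ u ⌋ c (x u)) ⟩
  ∑ (λ u → x u * c * δ v u)
    ≡⟨ ∑-*-δ (λ u → x u * c) v ⟩
  x v * c
    ≡⟨ ℤP.*-comm (x v) c ⟩
  c * x v
    ∎
  where open ≡-Reasoning

applyLaplacian-as-differences : ∀ {m} (A : Adjacency m) (x : Fin m → ℤ) (v : Fin m) →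
  applyLaplacian A x v ≡ ∑ (λ w → b2z (A v w) * (x v - x w))
applyLaplacian-as-differences {m} A x v = begin
  ∑ (λ w → laplacian A v w * x w)           ≡⟨ ∑-cong (λ w → distrib (diag w) (adj w) (x w)) ⟩
  ∑ (λ w → diag w * x w - adj w * x w)      ≡⟨ ∑-distrib-- (λ w → diag w * x w) (λ w → adj w * x w) ⟩
  ∑ (λ w → diag w * x w) - ∑ (λ w → adj w * x w)
    ≡⟨ cong (_- ∑ (λ w → adj w * x w))
         (trans (∑-diagonal (vdeg A v) x v) (sym (∑-distribʳ-* adj (x v)))) ⟩
  ∑ (λ w → adj w * x v) - ∑ (λ w → adj w * x w)
    ≡⟨ sym (∑-distrib-- (λ w → adj w * x v) (λ w → adj w * x w)) ⟩
  ∑ (λ w → adj w * x v - adj w * x w)       ≡⟨ ∑-cong (λ w → factor (adj w) (x v) (x w)) ⟩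
  ∑ (λ w → adj w * (x v - x w))             ∎
  where
  open ≡-Reasoning
  diag adj : Fin m → ℤ
  diag w = if ⌊ v ≟ w ⌋ then vdeg A v else + 0
  adj w = b2z (A v w)
  distrib : ∀ a b c → (a - b) * c ≡ a * c - b * c
  distrib = solve-∀
  factor : ∀ a b c → a * b - a * c ≡ a * (b - c)
  factor = solve-∀

applyLaplacian-zero : ∀ {m} (A : Adjacency m) (v : Fin m) → applyLaplacian A (λ _ → + 0) v ≡ + 0
applyLaplacian-zero {m} A v = trans (∑-cong (λ w → ℤP.*-zeroʳ (laplacian A v w))) (∑-zero m)

applyLaplacian-neg-δ : ∀ {m} (A : Adjacency m) (u v : Fin m) →
  applyLaplacian A (λ w → - δ u w) v ≡ - laplacian A v u
applyLaplacian-neg-δ A u v = begin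
  ∑ (λ w → laplacian A v w * - δ u w)
    ≡⟨ ∑-cong (λ w → sym (ℤP.neg-distribʳ-* (laplacian A v w) (δ u w))) ⟩
  ∑ (λ w → - (laplacian A v w * δ u w))
    ≡⟨ ∑-neg (λ w → laplacian A v w * δ u w) ⟩
  - ∑ (λ w → laplacian A v w * δ u w)
    ≡⟨ cong -_ (∑-*-δ (laplacian A v) u) ⟩
  - laplacian A v u
    ∎
  where open ≡-Reasoning

equivEffective-resp-≗ : ∀ {m} {A : Adjacency m} {D₁ D₂ : Divisor m} →
  (∀ v → D₁ v ≡ D₂ v) → EquivEffective A D₁ → EquivEffective A D₂
equivEffective-resp-≗ D₁≗D₂ (D' , D'-eff , x , D₁-D'≡Qx) =
  D' , D'-eff , x , λ v → trans (cong (_- D' _) (sym (D₁≗D₂ v))) (D₁-D'≡Qx v)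

effective⇒equivEffective : ∀ {m} {A : Adjacency m} {D : Divisor m} → Effective D → EquivEffective A D
effective⇒equivEffective {A = A} {D} D-eff =
  D , D-eff , (λ _ → + 0) , λ v → trans (ℤP.+-inverseʳ (D v)) (sym (applyLaplacian-zero A v))

borrowing-equivalent : ∀ {m} (A : Adjacency m) (D : Divisor m) (u : Fin m) →
  Equivalent A D (λ v → D v + laplacian A v u)
borrowing-equivalent A D u = (λ w → - δ u w) , λ v →
  trans (cancel (D v) (laplacian A v u)) (sym (applyLaplacian-neg-δ A u v))
  where
  cancel : ∀ d l → d - (d + l) ≡ - l
  cancel = solve-∀

equivEffective⇒laplacian≤ : ∀ {m} {A : Adjacency m} {D : Divisor m} → EquivEffective A D →
  Σ (Fin m → ℤ) λ x → ∀ v → applyLaplacian A x v ≤ D v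
equivEffective⇒laplacian≤ (D' , D'-eff , x , D-D'≡Qx) =
  x , λ v → subst (_≤ _) (D-D'≡Qx v) (i-j≤i (D'-eff v))

argmax : ∀ {m} (x : Fin (suc m) → ℤ) → ∃ λ w → ∀ v → x v ≤ x w
argmax {zero}  x = zero , λ { zero → ℤP.≤-refl }
argmax {suc m} x with argmax (λ i → x (suc i))
... | w , max with x zero ℤ.≤? x (suc w)
...   | yes x₀≤ = suc w , λ { zero → x₀≤ ; (suc v) → max v }
...   | no  x₀≰ = zero , λ { zero → ℤP.≤-refl
                           ; (suc v) → ℤP.≤-trans (max v) (ℤP.<⇒≤ (ℤP.≰⇒> x₀≰)) }

module _ {m} (A : Adjacency m) (x : Fin m → ℤ) {w : Fin m} (w-max : ∀ u → x u ≤ x w) where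

  private
    outflow : Fin m → ℤ
    outflow u = b2z (A w u) * (x w - x u)

    outflow-nonneg : ∀ u → + 0 ≤ outflow u
    outflow-nonneg u with A w u
    ... | true  = subst (+ 0 ≤_) (sym (ℤP.*-identityˡ (x w - x u))) (ℤP.i≤j⇒0≤j-i (w-max u))
    ... | false = subst (+ 0 ≤_) (sym (ℤP.*-zeroˡ (x w - x u))) ℤP.≤-refl

    outflow-pos : ∀ {u} → T (A w u) → x u ≢ x w → + 1 ≤ outflow u
    outflow-pos {u} wu xu≢xw rewrite b2z-T wu | ℤP.*-identityˡ (x w - x u) =
      <⇒1≤- (ℤP.≤∧≢⇒< (w-max u) xu≢xw)

    applyLaplacian≡∑outflow : applyLaplacian A x w ≡ ∑ outflow
    applyLaplacian≡∑outflow = applyLaplacian-as-differences A x w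

  laplacian-nonneg-at-max : + 0 ≤ applyLaplacian A x w
  laplacian-nonneg-at-max = subst (+ 0 ≤_) (sym applyLaplacian≡∑outflow) (∑-nonneg outflow-nonneg)

  laplacian-pos-at-max : ∀ {u} → T (A w u) → x u ≢ x w → + 1 ≤ applyLaplacian A x w
  laplacian-pos-at-max wu xu≢xw = subst (+ 1 ≤_) (sym applyLaplacian≡∑outflow)
    (ℤP.≤-trans (outflow-pos wu xu≢xw) (term≤∑ outflow-nonneg _))

  laplacian-≥2-at-max : ∀ {u u'} → u ≢ u' → T (A w u) → T (A w u') → x u ≢ x w → x u' ≢ x w →
    + 2 ≤ applyLaplacian A x w
  laplacian-≥2-at-max u≢u' wu wu' xu≢xw xu'≢xw = subst (+ 2 ≤_) (sym applyLaplacian≡∑outflow)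
    (ℤP.≤-trans (ℤP.+-mono-≤ (outflow-pos wu xu≢xw) (outflow-pos wu' xu'≢xw))
                (two-terms≤∑ outflow-nonneg u≢u'))

-- The cycle

data CycleNeighbours {n} (i j : Fin n) : Set where
  forward  : toℕ j ≡ suc (toℕ i) → CycleNeighbours i j
  backward : toℕ i ≡ suc (toℕ j) → CycleNeighbours i j
  wrapˡ    : toℕ i ≡ 0 → suc (toℕ j) ≡ n → CycleNeighbours i j
  wrapʳ    : toℕ j ≡ 0 → suc (toℕ i) ≡ n → CycleNeighbours i j

module _ {n} {i j : Fin n} where

  private
    isForward isBackward isWrapˡ : Bool
    isForward = ⌊ toℕ j ℕ.≟ suc (toℕ i) ⌋
    isBackward = ⌊ toℕ i ℕ.≟ suc (toℕ j) ⌋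
    isWrapˡ = ⌊ toℕ i ℕ.≟ 0 ⌋ ∧ ⌊ suc (toℕ j) ℕ.≟ n ⌋

  cycleAdj⇒neighbours : T (cycleAdj i j) → CycleNeighbours i j
  cycleAdj⇒neighbours adj with to (T-∨ {isForward}) adj
  ... | inj₁ p = forward (toWitness p)
  ... | inj₂ adj′ with to (T-∨ {isBackward}) adj′
  ...   | inj₁ p = backward (toWitness p)
  ...   | inj₂ adj″ with to (T-∨ {isWrapˡ}) adj″
  ...     | inj₁ p = let (p₁ , p₂) = to (T-∧ {⌊ toℕ i ℕ.≟ 0 ⌋}) p in
                     wrapˡ (toWitness {a? = toℕ i ℕ.≟ 0} p₁) (toWitness {a? = suc (toℕ j) ℕ.≟ n} p₂)
  ...     | inj₂ p = let (p₁ , p₂) = to (T-∧ {⌊ toℕ j ℕ.≟ 0 ⌋}) p in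
                     wrapʳ (toWitness {a? = toℕ j ℕ.≟ 0} p₁) (toWitness {a? = suc (toℕ i) ℕ.≟ n} p₂)

  neighbours⇒cycleAdj : CycleNeighbours i j → T (cycleAdj i j)
  neighbours⇒cycleAdj (forward p) = from (T-∨ {isForward}) (inj₁ (fromWitness p))
  neighbours⇒cycleAdj (backward p) =
    from (T-∨ {isForward}) (inj₂ (from (T-∨ {isBackward}) (inj₁ (fromWitness p))))
  neighbours⇒cycleAdj (wrapˡ p q) =
    from (T-∨ {isForward}) (inj₂ (from (T-∨ {isBackward}) (inj₂ (from (T-∨ {isWrapˡ})
      (inj₁ (from (T-∧ {⌊ toℕ i ℕ.≟ 0 ⌋}) (fromWitness p , fromWitness q)))))))
  neighbours⇒cycleAdj (wrapʳ p q) =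
    from (T-∨ {isForward}) (inj₂ (from (T-∨ {isBackward}) (inj₂ (from (T-∨ {isWrapˡ})
      (inj₂ (from (T-∧ {⌊ toℕ j ℕ.≟ 0 ⌋}) (fromWitness p , fromWitness q)))))))

neighbours-sym : ∀ {n} {i j : Fin n} → CycleNeighbours i j → CycleNeighbours j i
neighbours-sym (forward p)  = backward p
neighbours-sym (backward p) = forward p
neighbours-sym (wrapˡ p q)  = wrapʳ p q
neighbours-sym (wrapʳ p q)  = wrapˡ p q

neighbours-irrefl : ∀ {n} {i : Fin n} → 2 ℕ.≤ n → ¬ CycleNeighbours i i
neighbours-irrefl _ (forward p)  = ℕP.1+n≢n (sym p)
neighbours-irrefl _ (backward p) = ℕP.1+n≢n (sym p)
neighbours-irrefl 2≤n (wrapˡ p q) = ℕP.<⇒≢ 2≤n (trans (cong suc (sym p)) q)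
neighbours-irrefl 2≤n (wrapʳ p q) = ℕP.<⇒≢ 2≤n (trans (cong suc (sym p)) q)

rot : ∀ {m} → Fin (suc m) → Fin (suc m)
rot {m} i with m ℕ.≟ toℕ i
... | yes _  = zero
... | no m≢i = suc (lower₁ i m≢i)

rot-fromℕ : ∀ m → rot (fromℕ m) ≡ zero
rot-fromℕ m with m ℕ.≟ toℕ (fromℕ m)
... | yes _  = refl
... | no m≢m = contradiction (sym (FinP.toℕ-fromℕ m)) m≢m

rot-inject₁ : ∀ {m} (i : Fin m) → rot (inject₁ i) ≡ suc i
rot-inject₁ {m} i with m ℕ.≟ toℕ (inject₁ i)
... | yes m≡i = contradiction m≡i (FinP.toℕ-inject₁-≢ i)
... | no m≢i  = cong suc (FinP.lower₁-inject₁′ i m≢i)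

data LastOrInject₁ {m} : Fin (suc m) → Set where
  last   : LastOrInject₁ (fromℕ m)
  inject : (i : Fin m) → LastOrInject₁ (inject₁ i)

lastOrInject₁ : ∀ {m} (i : Fin (suc m)) → LastOrInject₁ i
lastOrInject₁ {zero}  zero    = last
lastOrInject₁ {suc m} zero    = inject zero
lastOrInject₁ {suc m} (suc i) with lastOrInject₁ i
... | last     = last
... | inject j = inject (suc j)

neighbours-rot : ∀ {m} (i : Fin (suc m)) → CycleNeighbours i (rot i)
neighbours-rot {m} i with lastOrInject₁ i
... | last     rewrite rot-fromℕ m = wrapʳ refl (cong suc (FinP.toℕ-fromℕ m))
... | inject j rewrite rot-inject₁ j = forward (cong suc (sym (FinP.toℕ-inject₁ j)))

rot-≢ : ∀ {m} → 1 ℕ.≤ m → (i : Fin (suc m)) → rot i ≢ i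
rot-≢ 1≤m i rot-i≡i = neighbours-irrefl (s≤s 1≤m) (subst (CycleNeighbours i) rot-i≡i (neighbours-rot i))

rot-closed⇒all : ∀ {m} {P : Fin (suc m) → Set} → (∀ i → P i → P (rot i)) →
  ∀ {i} → P i → ∀ j → P j
rot-closed⇒all {m} {P} closed {i} Pi = <-weakInduction P P-zero step
  where
  step : ∀ j → P (inject₁ j) → P (suc j)
  step j P-j = subst P (rot-inject₁ j) (closed (inject₁ j) P-j)
  P-last : P (fromℕ m)
  P-last = <-weakInduction-startingFrom P Pi step (FinP.≤fromℕ i)
  P-zero : P zero
  P-zero = subst P (rot-fromℕ m) (closed (fromℕ m) P-last)

∑-rot : ∀ {m} (f : Fin (suc m) → ℤ) → ∑ (λ i → f (rot i)) ≡ ∑ f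
∑-rot {m} f = begin
  ∑ (λ i → f (rot i))
    ≡⟨ ∑-init-last (λ i → f (rot i)) ⟩
  ∑ (λ i → f (rot (inject₁ i))) + f (rot (fromℕ m))
    ≡⟨ cong₂ _+_ (∑-cong (λ i → cong f (rot-inject₁ i))) (cong f (rot-fromℕ m)) ⟩
  ∑ (λ i → f (suc i)) + f zero
    ≡⟨ ℤP.+-comm _ (f zero) ⟩
  ∑ f
    ∎
  where open ≡-Reasoning

zero-or-∑≥length : ∀ {m} {f : Fin m → ℤ} → (∀ i → + 0 ≤ f i) → (∀ i → f i ≤ + 1) →
  (∃ λ i → f i ≡ + 0) ⊎ + m ≤ ∑ f
zero-or-∑≥length {f = f} f≥0 f≤1 with FinP.any? (λ i → f i ℤ.≟ + 0)
... | yes has-zero = inj₁ has-zero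
... | no  ¬zero    = inj₂ (∑-≥-length one)
  where
  one : ∀ i → + 1 ≤ f i
  one i with zero-or-one (f≥0 i) (f≤1 i)
  ... | inj₁ fi≡0 = contradiction (i , fi≡0) ¬zero
  ... | inj₂ fi≡1 = ℤP.≤-reflexive (sym fi≡1)

adjacent-zeros-or-∑≥half : ∀ {m} {f : Fin (suc m) → ℤ} →
  (∀ i → + 0 ≤ f i) → (∀ i → f i ≤ + 1) → (∃ λ i → f i ≡ + 0 × f (rot i) ≡ + 0) ⊎ + ⌈ suc m /2⌉ ≤ ∑ f
adjacent-zeros-or-∑≥half {m} {f} f≥0 f≤1 with FinP.any? (λ i → f i ℤ.≟ + 0 ×-dec f (rot i) ℤ.≟ + 0)
... | yes zeros   = inj₁ zeros
... | no  ¬zeros = inj₂ (⌈/2⌉-≤ (subst (+ suc m ≤_) ∑-pairs≡2∑ (∑-≥-length pair)))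
  where
  pair : ∀ i → + 1 ≤ f i + f (rot i)
  pair i with zero-or-one (f≥0 i) (f≤1 i) | zero-or-one (f≥0 (rot i)) (f≤1 (rot i))
  ... | inj₁ fi≡0 | inj₁ fri≡0 = contradiction (i , fi≡0 , fri≡0) ¬zeros
  ... | inj₂ fi≡1 | _          =
    subst (λ a → + 1 ≤ a + f (rot i)) (sym fi≡1) (ℤP.+-monoʳ-≤ (+ 1) (f≥0 (rot i)))
  ... | inj₁ fi≡0 | inj₂ fri≡1 = subst₂ (λ a b → + 1 ≤ a + b) (sym fi≡0) (sym fri≡1) ℤP.≤-refl
  ∑-pairs≡2∑ : ∑ (λ i → f i + f (rot i)) ≡ ∑ f + ∑ f
  ∑-pairs≡2∑ = trans (∑-distrib-+ f (λ i → f (rot i))) (cong (_+_ (∑ f)) (∑-rot f))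

-- The wheel: a divisor of degree ⌈ n /2⌉ + 1 and rank one

even : ℕ → Bool
even zero    = true
even (suc k) = not (even k)

∑-even : ∀ k → ∑ {k} (λ i → b2z (even (toℕ i))) ≡ + ⌈ k /2⌉
∑-odd  : ∀ k → ∑ {k} (λ i → b2z (not (even (toℕ i)))) ≡ + ⌊ k /2⌋
∑-even zero    = refl
∑-even (suc k) = cong (_+_ (+ 1)) (∑-odd k)
∑-odd  zero    = refl
∑-odd  (suc k) = begin
  + 0 + ∑ {k} (λ i → b2z (not (not (even (toℕ i)))))
    ≡⟨ ℤP.+-identityˡ _ ⟩
  ∑ {k} (λ i → b2z (not (not (even (toℕ i)))))
    ≡⟨ ∑-cong {k} (λ i → cong b2z (not-involutive (even (toℕ i)))) ⟩
  ∑ {k} (λ i → b2z (even (toℕ i)))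
    ≡⟨ ∑-even k ⟩
  + ⌈ k /2⌉
    ∎
  where open ≡-Reasoning

neighbour-of-odd-is-even : ∀ {n} {i j : Fin n} → CycleNeighbours j i →
  even (toℕ i) ≡ false → even (toℕ j) ≡ true
neighbour-of-odd-is-even (forward p)  i-odd = not-injective (subst (λ k → even k ≡ false) p i-odd)
neighbour-of-odd-is-even (backward p) i-odd = subst (λ k → even k ≡ true) (sym p) (cong not i-odd)
neighbour-of-odd-is-even (wrapˡ p _)  i-odd = subst (λ k → even k ≡ true) (sym p) refl
neighbour-of-odd-is-even (wrapʳ p _)  i-odd with () ← subst (λ k → even k ≡ false) p i-odd

hubAndEvens : ∀ {n} → Divisor (suc n)
hubAndEvens zero    = + 1
hubAndEvens (suc i) = b2z (even (toℕ i))

hubAndEvens-effective : ∀ {n} → Effective (hubAndEvens {n})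
hubAndEvens-effective zero    = +≤+ z≤n
hubAndEvens-effective (suc i) = b2z-nonneg _

hubAndEvens≤1 : ∀ {n} (v : Fin (suc n)) → hubAndEvens v ≤ + 1
hubAndEvens≤1 zero    = ℤP.≤-refl
hubAndEvens≤1 (suc i) = b2z≤1 _

hubAndEvens-degree : ∀ n → degree (hubAndEvens {n}) ≡ + (⌈ n /2⌉ ℕ.+ 1)
hubAndEvens-degree n = trans (cong (_+_ (+ 1)) (∑-even n)) (cong +_ (ℕP.+-comm 1 ⌈ n /2⌉))

effective-minus-δ : ∀ {m} {D : Divisor m} {v : Fin m} → Effective D → + 1 ≤ D v → Effective (D -ᴰ δ v)
effective-minus-δ {v = v} D≥0 Dv≥1 w with v ≟ w
... | yes refl = ℤP.i≤j⇒0≤j-i Dv≥1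
... | no  _    = ℤP.i≤j⇒0≤j-i (D≥0 w)

module _ {n} (2≤n : 2 ℕ.≤ n) {i : Fin n} (i-odd : even (toℕ i) ≡ false) where

  private
    W = wheel n

    neighbours-covered : ∀ w → b2z (W w (suc i)) ≤ hubAndEvens w
    neighbours-covered zero = ℤP.≤-refl
    neighbours-covered (suc j) with T? (cycleAdj j i)
    ... | yes adj = subst₂ _≤_ (sym (b2z-T adj)) (cong b2z (sym j-even)) ℤP.≤-refl
      where
      j-even : even (toℕ j) ≡ true
      j-even = neighbour-of-odd-is-even (cycleAdj⇒neighbours {i = j} {i} adj) i-odd
    ... | no ¬adj = subst (_≤ _) (sym (b2z-¬T ¬adj)) (b2z-nonneg _)

    hub-adjacent : + 1 ≤ vdeg W (suc i)
    hub-adjacent = term≤∑ (λ u → b2z-nonneg (W (suc i) u)) zero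

  borrowing-at-odd-effective : Effective (λ w → (hubAndEvens -ᴰ δ (suc i)) w + laplacian W w (suc i))
  borrowing-at-odd-effective w with w ≟ suc i
  ... | yes refl
    rewrite δ-self (suc i) | i-odd | b2z-¬T (neighbours-irrefl 2≤n ∘ cycleAdj⇒neighbours {i = i} {i}) =
    subst (+ 0 ≤_) (shift (vdeg W (suc i))) (ℤP.i≤j⇒0≤j-i hub-adjacent)
    where
    shift : ∀ d → d - + 1 ≡ + 0 - + 1 + (d - + 0)
    shift = solve-∀
  ... | no w≢v rewrite δ-other (w≢v ∘ sym) =
    subst (+ 0 ≤_) (shift (hubAndEvens w) (b2z (W w (suc i)))) (ℤP.i≤j⇒0≤j-i (neighbours-covered w))
    where
    shift : ∀ d a → d - a ≡ d - + 0 + (+ 0 - a)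
    shift = solve-∀

hubAndEvens-minus-δ : ∀ {n} → 2 ℕ.≤ n → ∀ v → EquivEffective (wheel n) (hubAndEvens -ᴰ δ v)
hubAndEvens-minus-δ 2≤n zero =
  effective⇒equivEffective {A = wheel _} (effective-minus-δ {v = zero} hubAndEvens-effective ℤP.≤-refl)
hubAndEvens-minus-δ 2≤n (suc i) with even (toℕ i) in i-parity
... | true  = effective⇒equivEffective {A = wheel _}
                (effective-minus-δ {v = suc i} hubAndEvens-effective (ℤP.≤-reflexive (sym (cong b2z i-parity))))
... | false =
  _ , borrowing-at-odd-effective 2≤n i-parity , borrowing-equivalent (wheel _) (hubAndEvens -ᴰ δ (suc i)) (suc i)

hubAndEvens-rank : ∀ {n} → 2 ℕ.≤ n → RankAtLeast (wheel n) hubAndEvens 1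
hubAndEvens-rank 2≤n E E-eff E-deg with degree-one-effective E-eff E-deg
... | v , E≗δv = equivEffective-resp-≗ {A = wheel _} (λ w → cong (_-_ (hubAndEvens w)) (sym (E≗δv w)))
                   (hubAndEvens-minus-δ 2≤n v)

-- The wheel: every candidate has degree at least ⌈ n /2⌉ + 1

rank-one-firing : ∀ {m} {A : Adjacency m} {D : Divisor m} → RankAtLeast A D 1 → ∀ q → D q ≡ + 0 →
  Σ (Fin m → ℤ) λ x → (∀ v → applyLaplacian A x v ≤ D v) × applyLaplacian A x q < + 0
rank-one-firing rank q Dq≡0 with equivEffective⇒laplacian≤ (rank (δ q) (δ-effective q) (degree-δ q))
... | x , Qx≤D-δq =
  x , (λ v → ℤP.≤-trans (Qx≤D-δq v) (i-j≤i (δ-effective q v))) ,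
  ℤP.≤-<-trans (subst (_ ≤_) (cong₂ _-_ Dq≡0 (δ-self q)) (Qx≤D-δq q)) -<+

module _ {m} (1≤m : 1 ℕ.≤ m) {D : Divisor (suc (suc m))} (D≤1 : ∀ v → D v ≤ + 1)
         (x : Fin (suc (suc m)) → ℤ) (Qx≤D : ∀ v → applyLaplacian (wheel (suc m)) x v ≤ D v) where

  private
    W = wheel (suc m)

    AtMax : Fin (suc (suc m)) → Set
    AtMax v = x v ≡ x (proj₁ (argmax x))

    at-max⇒max : ∀ {w} → AtMax w → ∀ u → x u ≤ x w
    at-max⇒max w-top u = subst (x u ≤_) (sym w-top) (proj₂ (argmax x) u)

    negative⇒below-max : ∀ {v} → applyLaplacian W x v < + 0 → ¬ AtMax v
    negative⇒below-max Qv<0 v-top = ℤP.<⇒≱ Qv<0 (laplacian-nonneg-at-max W x (at-max⇒max v-top))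

    empty-next-to-below-max : ∀ {v u} → D v ≡ + 0 → T (W v u) → ¬ AtMax u → ¬ AtMax v
    empty-next-to-below-max {v} Dv≡0 vu ¬u-top v-top = +suc≰+ (ℤP.≤-trans
      (laplacian-pos-at-max W x (at-max⇒max v-top) vu (λ xu≡xv → ¬u-top (trans xu≡xv v-top)))
      (subst (_ ≤_) Dv≡0 (Qx≤D v)))

    two-neighbours-below-max : ∀ {v u u'} → u ≢ u' → T (W v u) → T (W v u') →
      ¬ AtMax u → ¬ AtMax u' → ¬ AtMax v
    two-neighbours-below-max {v} u≢u' vu vu' ¬u-top ¬u'-top v-top = +suc≰+ (ℤP.≤-trans
      (laplacian-≥2-at-max W x (at-max⇒max v-top) u≢u' vu vu'
        (λ xu≡xv → ¬u-top (trans xu≡xv v-top)) (λ xu'≡xv → ¬u'-top (trans xu'≡xv v-top)))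
      (ℤP.≤-trans (Qx≤D v) (D≤1 v)))

    hub-below-max⇒rim-at-max : ¬ AtMax zero → ∀ i → AtMax (suc i)
    hub-below-max⇒rim-at-max ¬hub-top =
      rot-closed⇒all {P = λ i → AtMax (suc i)} closed (proj₂ (on-rim (proj₁ (argmax x)) refl))
      where
      on-rim : ∀ v → AtMax v → ∃ λ i → AtMax (suc i)
      on-rim zero    hub-top = contradiction hub-top ¬hub-top
      on-rim (suc i) i-top   = i , i-top
      closed : ∀ i → AtMax (suc i) → AtMax (suc (rot i))
      closed i i-top = decidable-stable (x (suc (rot i)) ℤ.≟ _) λ ¬next-top →
        two-neighbours-below-max (λ ()) tt (neighbours⇒cycleAdj (neighbours-rot i)) ¬hub-top ¬next-top i-top

  no-firing-from-hub : applyLaplacian (wheel (suc m)) x zero < + 0 → ∀ z → D (suc z) ≢ + 0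
  no-firing-from-hub Qhub<0 z Dz≡0 =
    empty-next-to-below-max Dz≡0 tt ¬hub-top (hub-below-max⇒rim-at-max ¬hub-top z)
    where
    ¬hub-top = negative⇒below-max Qhub<0

  no-firing-from-rim : ∀ u → applyLaplacian (wheel (suc m)) x (suc u) < + 0 → D (suc (rot u)) ≢ + 0
  no-firing-from-rim u Qu<0 Dru≡0 = ¬u-top (hub-below-max⇒rim-at-max ¬hub-top u)
    where
    ¬u-top = negative⇒below-max Qu<0
    ¬ru-top = empty-next-to-below-max Dru≡0 (neighbours⇒cycleAdj (neighbours-sym (neighbours-rot u))) ¬u-top
    ¬hub-top = two-neighbours-below-max (λ u≡ru → rot-≢ 1≤m u (sym (FinP.suc-injective u≡ru)))
                 tt tt ¬u-top ¬ru-top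

rim : ∀ {m} → Divisor (suc (suc m)) → Fin (suc m) → ℤ
rim D i = D (suc i)

module _ {m} (1≤m : 1 ℕ.≤ m) {D : Divisor (suc (suc m))} (D-candidate : MfgonCandidate (wheel (suc m)) D) where

  private
    D≥0 = proj₁ D-candidate
    D≤1 = proj₁ (proj₂ D-candidate)
    rank = proj₂ (proj₂ D-candidate)

  empty-hub-degree : D zero ≡ + 0 → + (⌈ suc m /2⌉ ℕ.+ 1) ≤ degree D
  empty-hub-degree hub≡0 with zero-or-∑≥length (λ i → D≥0 (suc i)) (λ i → D≤1 (suc i))
  ... | inj₁ (z , Dz≡0) with rank-one-firing {A = wheel (suc m)} rank zero hub≡0
  ...   | x , Qx≤D , Qhub<0 = contradiction Dz≡0 (no-firing-from-hub 1≤m D≤1 x Qx≤D Qhub<0 z)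
  empty-hub-degree hub≡0 | inj₂ rim≥length = begin
    + (⌈ suc m /2⌉ ℕ.+ 1) ≤⟨ +≤+ (⌈/2⌉+1≤ (s≤s 1≤m)) ⟩
    + suc m               ≤⟨ rim≥length ⟩
    ∑ (rim D)             ≡⟨ ℤP.+-identityˡ (∑ (rim D)) ⟨
    + 0 + ∑ (rim D)       ≡⟨ cong (_+ ∑ (rim D)) hub≡0 ⟨
    degree D              ∎
    where open ℤP.≤-Reasoning

  full-hub-degree : D zero ≡ + 1 → + (⌈ suc m /2⌉ ℕ.+ 1) ≤ degree D
  full-hub-degree hub≡1 with adjacent-zeros-or-∑≥half (λ i → D≥0 (suc i)) (λ i → D≤1 (suc i))
  ... | inj₁ (u , Du≡0 , Dru≡0) with rank-one-firing {A = wheel (suc m)} rank (suc u) Du≡0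
  ...   | x , Qx≤D , Qu<0 = contradiction Dru≡0 (no-firing-from-rim 1≤m D≤1 x Qx≤D u Qu<0)
  full-hub-degree hub≡1 | inj₂ rim≥half = begin
    + (⌈ suc m /2⌉ ℕ.+ 1) ≡⟨ cong +_ (ℕP.+-comm ⌈ suc m /2⌉ 1) ⟩
    + 1 + + ⌈ suc m /2⌉    ≤⟨ ℤP.+-monoʳ-≤ (+ 1) rim≥half ⟩
    + 1 + ∑ (rim D)        ≡⟨ cong (_+ ∑ (rim D)) hub≡1 ⟨
    degree D               ∎
    where open ℤP.≤-Reasoning

  candidate-degree : + (⌈ suc m /2⌉ ℕ.+ 1) ≤ degree D
  candidate-degree with zero-or-one (D≥0 zero) (D≤1 zero)
  ... | inj₁ hub≡0 = empty-hub-degree hub≡0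
  ... | inj₂ hub≡1 = full-hub-degree hub≡1

corollary5p4 : (n : ℕ) → 3 ℕ.≤ n → IsMfgon (wheel n) (⌈ n /2⌉ ℕ.+ 1)
corollary5p4 (suc m) (s≤s 2≤m) =
  (hubAndEvens , (hubAndEvens-effective , hubAndEvens≤1 , hubAndEvens-rank 2≤n) , hubAndEvens-degree (suc m)) ,
  λ D → candidate-degree 1≤m
  where
  2≤n : 2 ℕ.≤ suc m
  2≤n = ℕP.m≤n⇒m≤1+n 2≤m
  1≤m : 1 ℕ.≤ m
  1≤m = ℕP.≤-trans (s≤s z≤n) 2≤m
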